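{- Let $\phi$ be an $\mathrm{LTL}^{>}$ formula whose occurrences of $\mathbf{R}^{>}$ are labelled $\mathbf{R}^{>}_1,\dots,\mathbf{R}^{>}_k$, with associated counters $\gamma_1,\dots,\gamma_k$, and consider the $\varepsilon$-reduction of sets of formulae described below. If, whenever a non-reduced set $Y$ is reduced, the formula of $Y$ that is reduced is a largest one (for the sub-formula ordering) among the non-reduced formulae of $Y$, then along any chain of consecutive $\varepsilon$-transitions, for each counter $\gamma_i$ at most one counter action on $\gamma_i$ occurs.
   Context: $\mathrm{LTL}^{>}$ formulae over atomic propositions $AP$ are given by $\phi ::= a \mid \neg a \mid \phi\vee\phi \mid \phi\wedge\phi \mid \phi\mathbf{U}\phi \mid \phi\mathbf{R}\phi \mid \mathbf{X}\phi \mid \phi\mathbf{R}^{>}\phi$ ($a\in AP$). A formula is reduced if it is a literal ($a$ or $\neg a$) or of the form $\mathbf{X}\psi$; a set of formulae is reduced if all its elements are reduced. Counter actions are: $\mathtt{i}$ (increment), $\mathtt{or}$ (observe the current value then reset to 0), and $\varepsilon$ (no action); $\mathtt{i}_i$, $\mathtt{or}_i$ denote these actions on counter $\gamma_i$. The automaton states are sets of sub-formulae of $\phi$. From a set $Y$ containing a non-reduced formula $\psi$, the following $\varepsilon$-transitions (labelled with counter actions) are available, where $Y'=Y\setminus\{\psi\}$: - if $\psi=\psi_1\wedge\psi_2$: $Y\to Y'\cup\{\psi_1,\psi_2\}$ with no counter action; - if $\psi=\psi_1\vee\psi_2$: $Y\to Y'\cup\{\psi_1\}$ and $Y\to Y'\cup\{\psi_2\}$,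 no counter action; - if $\psi=\psi_1\mathbf{U}\psi_2$: $Y\to Y'\cup\{\psi_2\}$ and $Y\to Y'\cup\{\psi_1,\mathbf{X}\psi\}$, no counter action; - if $\psi=\psi_1\mathbf{R}\psi_2$: $Y\to Y'\cup\{\psi_1,\psi_2\}$ and $Y\to Y'\cup\{\psi_2,\mathbf{X}\psi\}$, no counter action; - if $\psi=\psi_1\mathbf{R}^{>}_i\psi_2$: $Y\to Y'\cup\{\psi_1,\psi_2\}$ with action $\mathtt{or}_i$; $Y\to Y'\cup\{\psi_1,\psi_2,\mathbf{X}\psi\}$ with action $\mathtt{i}_i$; and $Y\to Y'\cup\{\psi_2,\mathbf{X}\psi\}$ with no counter action. No $\varepsilon$-transitions leave a reduced set. A chain of $\varepsilon$-transitions is a sequence of such transitions, each starting from the target of the previous one. -}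

module Defs where

open import Data.Nat using (ℕ; zero; suc; _≡ᵇ_)
open import Data.Bool using (if_then_else_)
open import Data.List using (List; []; _∷_; _++_)
open import Data.Product using (Σ; _×_; _,_)
open import Data.Sum using (_⊎_)
open import Relation.Binary.PropositionalEquality using (_≡_; _≢_)
open import Relation.Nullary using (¬_)

AP : Set
AP = ℕ

-- LTL^> formulae; each R^> occurrence carries its label i (counter γ_i).
data Formula : Set where
  atom   : AP → Formula
  natom  : AP → Formula
  _∨'_   : Formula → Formula → Formula
  _∧'_   : Formula → Formula → Formula
  _U_    : Formula → Formula → Formula
  _R_    : Formula → Formula → Formula
  X      : Formula → Formula
  R>     : ℕ → Formula → Formula → Formula

labels : Formula → List ℕ
labels (atom a) = []
labels (natom a) = []
labels (ψ₁ ∨' ψ₂) = labels ψ₁ ++ labels ψ₂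
labels (ψ₁ ∧' ψ₂) = labels ψ₁ ++ labels ψ₂
labels (ψ₁ U ψ₂) = labels ψ₁ ++ labels ψ₂
labels (ψ₁ R ψ₂) = labels ψ₁ ++ labels ψ₂
labels (X ψ) = labels ψ
labels (R> i ψ₁ ψ₂) = i ∷ (labels ψ₁ ++ labels ψ₂)

data _⊑_ : Formula → Formula → Set where
  ⊑-refl : ∀ {ψ} → ψ ⊑ ψ
  ⊑-∨ˡ : ∀ {ψ a b} → ψ ⊑ a → ψ ⊑ (a ∨' b)
  ⊑-∨ʳ : ∀ {ψ a b} → ψ ⊑ b → ψ ⊑ (a ∨' b)
  ⊑-∧ˡ : ∀ {ψ a b} → ψ ⊑ a → ψ ⊑ (a ∧' b)
  ⊑-∧ʳ : ∀ {ψ a b} → ψ ⊑ b → ψ ⊑ (a ∧' b)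
  ⊑-Uˡ : ∀ {ψ a b} → ψ ⊑ a → ψ ⊑ (a U b)
  ⊑-Uʳ : ∀ {ψ a b} → ψ ⊑ b → ψ ⊑ (a U b)
  ⊑-Rˡ : ∀ {ψ a b} → ψ ⊑ a → ψ ⊑ (a R b)
  ⊑-Rʳ : ∀ {ψ a b} → ψ ⊑ b → ψ ⊑ (a R b)
  ⊑-X  : ∀ {ψ a} → ψ ⊑ a → ψ ⊑ X a
  ⊑-R>ˡ : ∀ {ψ i a b} → ψ ⊑ a → ψ ⊑ R> i a b
  ⊑-R>ʳ : ∀ {ψ i a b} → ψ ⊑ b → ψ ⊑ R> i a b

_⊏_ : Formula → Formula → Set
ψ ⊏ χ = (ψ ⊑ χ) × (ψ ≢ χ)

data Reduced : Formula → Set where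
  red-atom  : ∀ a → Reduced (atom a)
  red-natom : ∀ a → Reduced (natom a)
  red-X     : ∀ ψ → Reduced (X ψ)

FSet : Set₁
FSet = Formula → Set

-- the sets that are automaton states: sets of sub-formulae of φ
-- (together with their X-versions, which the transitions introduce)
InClosure : Formula → Formula → Set
InClosure φ χ = (χ ⊑ φ) ⊎ Σ Formula (λ ψ → (ψ ⊑ φ) × (χ ≡ X ψ))

_∖_ : FSet → Formula → FSet
(Y ∖ ψ) χ = Y χ × (χ ≢ ψ)

_⊕_ : FSet → Formula → FSet
(Y ⊕ ψ) χ = Y χ ⊎ (χ ≡ ψ)
infixl 5 _⊕_ _∖_

data Act : Set where
  inc : ℕ → Act
  or  : ℕ → Act
  ε   : Act

data Red (Y : FSet) : Formula → Act → FSet → Set where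
  r-∧  : ∀ a b → Red Y (a ∧' b) ε (Y ∖ (a ∧' b) ⊕ a ⊕ b)
  r-∨ˡ : ∀ a b → Red Y (a ∨' b) ε (Y ∖ (a ∨' b) ⊕ a)
  r-∨ʳ : ∀ a b → Red Y (a ∨' b) ε (Y ∖ (a ∨' b) ⊕ b)
  r-U₁ : ∀ a b → Red Y (a U b) ε (Y ∖ (a U b) ⊕ b)
  r-U₂ : ∀ a b → Red Y (a U b) ε (Y ∖ (a U b) ⊕ a ⊕ X (a U b))
  r-R₁ : ∀ a b → Red Y (a R b) ε (Y ∖ (a R b) ⊕ a ⊕ b)
  r-R₂ : ∀ a b → Red Y (a R b) ε (Y ∖ (a R b) ⊕ b ⊕ X (a R b))
  r-R>₁ : ∀ i a b → Red Y (R> i a b) (or i) (Y ∖ R> i a b ⊕ a ⊕ b)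
  r-R>₂ : ∀ i a b → Red Y (R> i a b) (inc i) (Y ∖ R> i a b ⊕ a ⊕ b ⊕ X (R> i a b))
  r-R>₃ : ∀ i a b → Red Y (R> i a b) ε (Y ∖ R> i a b ⊕ b ⊕ X (R> i a b))

MaximalNonReduced : FSet → Formula → Set
MaximalNonReduced Y ψ =
  Y ψ × ¬ Reduced ψ × (∀ χ → Y χ → ¬ Reduced χ → ¬ (ψ ⊏ χ))

data Step (Y : FSet) (a : Act) (Z : FSet) : Set₁ where
  step : ∀ ψ → MaximalNonReduced Y ψ → Red Y ψ a Z → Step Y a Z

data Chain : FSet → List Act → FSet → Set₁ where
  done : ∀ {Y} → Chain Y [] Y
  _▸_  : ∀ {Y Z W a as} → Step Y a Z → Chain Z as W → Chain Y (a ∷ as) W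

countOn : ℕ → List Act → ℕ
countOn i [] = 0
countOn i (inc j ∷ as) = if i ≡ᵇ j then suc (countOn i as) else countOn i as
countOn i (or j ∷ as) = if i ≡ᵇ j then suc (countOn i as) else countOn i as
countOn i (ε ∷ as) = countOn i as

-- A counter action on γ_i is emitted only when the occurrence ψ = ψ₁ R>_i ψ₂
-- itself is reduced. Because the labels of φ are pairwise distinct, every
-- sub-formula of φ containing label i has ψ as a sub-formula; as ψ is a largest
-- non-reduced formula of the current set, no other non-reduced formula there
-- contains label i, and the reduction only adds ψ₁, ψ₂ (free of label i) and
-- the reduced formula X ψ. That no non-reduced formula contains label i is then
-- preserved by every later reduction, so γ_i is never acted upon again.
module Submission where

open import Defs
open import Data.Nat using (ℕ; suc; _≤_; _≟_; z≤n)
open import Data.Nat.Properties using (≤-reflexive)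
open import Data.List using (List; []; _∷_; _++_)
open import Data.List.Membership.Propositional using (_∈_; _∉_)
open import Data.List.Membership.Propositional.Properties using (∈-++⁺ˡ; ∈-++⁺ʳ)
open import Data.List.Relation.Binary.Subset.Propositional using (_⊆_)
open import Data.List.Relation.Binary.Disjoint.Propositional using (Disjoint)
open import Data.List.Relation.Unary.All as All using ()
open import Data.List.Relation.Unary.All.Properties using (++⁻ˡ)
open import Data.List.Relation.Unary.AllPairs using ([]; _∷_)
open import Data.List.Relation.Unary.Any using (here; there)
open import Data.List.Relation.Unary.Unique.Propositional using (Unique)
open import Data.Product using (_×_; _,_)
open import Data.Sum using (_⊎_; inj₁; inj₂)
open import Data.Empty using (⊥-elim)
open import Function using (_∘_)
open import Relation.Nullary using (¬_; Dec; yes; no)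
open import Relation.Nullary.Decidable using (dec-true; dec-false)
open import Relation.Binary.PropositionalEquality using (_≡_; _≢_; refl; sym; trans; cong; subst; module ≡-Reasoning)

unique-++⁻ˡ : ∀ (xs : List ℕ) {ys} → Unique (xs ++ ys) → Unique xs
unique-++⁻ˡ []       _          = []
unique-++⁻ˡ (x ∷ xs) (x∉ ∷ xs!) = ++⁻ˡ xs x∉ ∷ unique-++⁻ˡ xs xs!

unique-++⁻ʳ : ∀ (xs : List ℕ) {ys} → Unique (xs ++ ys) → Unique ys
unique-++⁻ʳ []       ys!       = ys!
unique-++⁻ʳ (x ∷ xs) (_ ∷ xs!) = unique-++⁻ʳ xs xs!

unique-++⇒disjoint : ∀ (xs : List ℕ) {ys} → Unique (xs ++ ys) → Disjoint xs ys
unique-++⇒disjoint (x ∷ xs) (x∉ ∷ _)  (here refl , v∈ys)  = All.lookup x∉ (∈-++⁺ʳ xs v∈ys) refl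
unique-++⇒disjoint (x ∷ xs) (_ ∷ xs!) (there v∈xs , v∈ys) = unique-++⇒disjoint xs xs! (v∈xs , v∈ys)

⊑-trans : ∀ {χ ψ φ} → χ ⊑ ψ → ψ ⊑ φ → χ ⊑ φ
⊑-trans p ⊑-refl    = p
⊑-trans p (⊑-∨ˡ q)  = ⊑-∨ˡ (⊑-trans p q)
⊑-trans p (⊑-∨ʳ q)  = ⊑-∨ʳ (⊑-trans p q)
⊑-trans p (⊑-∧ˡ q)  = ⊑-∧ˡ (⊑-trans p q)
⊑-trans p (⊑-∧ʳ q)  = ⊑-∧ʳ (⊑-trans p q)
⊑-trans p (⊑-Uˡ q)  = ⊑-Uˡ (⊑-trans p q)
⊑-trans p (⊑-Uʳ q)  = ⊑-Uʳ (⊑-trans p q)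
⊑-trans p (⊑-Rˡ q)  = ⊑-Rˡ (⊑-trans p q)
⊑-trans p (⊑-Rʳ q)  = ⊑-Rʳ (⊑-trans p q)
⊑-trans p (⊑-X q)   = ⊑-X (⊑-trans p q)
⊑-trans p (⊑-R>ˡ q) = ⊑-R>ˡ (⊑-trans p q)
⊑-trans p (⊑-R>ʳ q) = ⊑-R>ʳ (⊑-trans p q)

labels-mono : ∀ {χ ψ} → χ ⊑ ψ → labels χ ⊆ labels ψ
labels-mono ⊑-refl             = λ x∈ → x∈
labels-mono (⊑-∨ˡ p)           = ∈-++⁺ˡ ∘ labels-mono p
labels-mono (⊑-∨ʳ {a = a} p)   = ∈-++⁺ʳ (labels a) ∘ labels-mono p
labels-mono (⊑-∧ˡ p)           = ∈-++⁺ˡ ∘ labels-mono p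
labels-mono (⊑-∧ʳ {a = a} p)   = ∈-++⁺ʳ (labels a) ∘ labels-mono p
labels-mono (⊑-Uˡ p)           = ∈-++⁺ˡ ∘ labels-mono p
labels-mono (⊑-Uʳ {a = a} p)   = ∈-++⁺ʳ (labels a) ∘ labels-mono p
labels-mono (⊑-Rˡ p)           = ∈-++⁺ˡ ∘ labels-mono p
labels-mono (⊑-Rʳ {a = a} p)   = ∈-++⁺ʳ (labels a) ∘ labels-mono p
labels-mono (⊑-X p)            = labels-mono p
labels-mono (⊑-R>ˡ p)          = there ∘ ∈-++⁺ˡ ∘ labels-mono p
labels-mono (⊑-R>ʳ {a = a} p)  = there ∘ ∈-++⁺ʳ (labels a) ∘ labels-mono p

unique-⊑ : ∀ {χ φ} → χ ⊑ φ → Unique (labels φ) → Unique (labels χ)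
unique-⊑ ⊑-refl                u       = u
unique-⊑ (⊑-∨ˡ {a = a} p)      u       = unique-⊑ p (unique-++⁻ˡ (labels a) u)
unique-⊑ (⊑-∨ʳ {a = a} p)      u       = unique-⊑ p (unique-++⁻ʳ (labels a) u)
unique-⊑ (⊑-∧ˡ {a = a} p)      u       = unique-⊑ p (unique-++⁻ˡ (labels a) u)
unique-⊑ (⊑-∧ʳ {a = a} p)      u       = unique-⊑ p (unique-++⁻ʳ (labels a) u)
unique-⊑ (⊑-Uˡ {a = a} p)      u       = unique-⊑ p (unique-++⁻ˡ (labels a) u)
unique-⊑ (⊑-Uʳ {a = a} p)      u       = unique-⊑ p (unique-++⁻ʳ (labels a) u)
unique-⊑ (⊑-Rˡ {a = a} p)      u       = unique-⊑ p (unique-++⁻ˡ (labels a) u)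
unique-⊑ (⊑-Rʳ {a = a} p)      u       = unique-⊑ p (unique-++⁻ʳ (labels a) u)
unique-⊑ (⊑-X p)               u       = unique-⊑ p u
unique-⊑ (⊑-R>ˡ {a = a} p)     (_ ∷ u) = unique-⊑ p (unique-++⁻ˡ (labels a) u)
unique-⊑ (⊑-R>ʳ {a = a} p)     (_ ∷ u) = unique-⊑ p (unique-++⁻ʳ (labels a) u)

labels-apart : ∀ {l r ψ χ x} → Unique (labels l ++ labels r) →
  ψ ⊑ l → χ ⊑ r → x ∈ labels ψ → x ∉ labels χ
labels-apart {l} u p q x∈ψ x∈χ =
  unique-++⇒disjoint (labels l) u (labels-mono p x∈ψ , labels-mono q x∈χ)

unique-head∉tail : ∀ {x : ℕ} {xs} → Unique (x ∷ xs) → x ∉ xs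
unique-head∉tail (x∉ ∷ _) x∈ = All.lookup x∉ x∈ refl

R>-label∉⊏ : ∀ {χ i a b} → Unique (labels (R> i a b)) → χ ⊏ R> i a b → i ∉ labels χ
R>-label∉⊏ u (⊑-refl , χ≢)            = ⊥-elim (χ≢ refl)
R>-label∉⊏ u (⊑-R>ˡ p , _)            = unique-head∉tail u ∘ ∈-++⁺ˡ ∘ labels-mono p
R>-label∉⊏ {a = a} u (⊑-R>ʳ p , _)    = unique-head∉tail u ∘ ∈-++⁺ʳ (labels a) ∘ labels-mono p

-- With distinct labels, the occurrences of sub-formulae form a tree in which
-- a label sits at a single node, so containing label i means lying above R>_i.
R>-⊑-labelled : ∀ {φ χ i a b} → Unique (labels φ) →
  R> i a b ⊑ φ → χ ⊑ φ → i ∈ labels χ → R> i a b ⊑ χ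
R>-⊑-labelled u p ⊑-refl _ = p
R>-⊑-labelled u ⊑-refl (⊑-R>ˡ q) m = ⊥-elim (unique-head∉tail u (∈-++⁺ˡ (labels-mono q m)))
R>-⊑-labelled {a = a} u ⊑-refl (⊑-R>ʳ q) m =
  ⊥-elim (unique-head∉tail u (∈-++⁺ʳ (labels a) (labels-mono q m)))
R>-⊑-labelled u (⊑-∨ˡ {a = a} p) (⊑-∨ˡ q) m = R>-⊑-labelled (unique-++⁻ˡ (labels a) u) p q m
R>-⊑-labelled u (⊑-∨ʳ {a = a} p) (⊑-∨ʳ q) m = R>-⊑-labelled (unique-++⁻ʳ (labels a) u) p q m
R>-⊑-labelled u (⊑-∨ˡ p) (⊑-∨ʳ q) m = ⊥-elim (labels-apart u p q (here refl) m)
R>-⊑-labelled u (⊑-∨ʳ p) (⊑-∨ˡ q) m = ⊥-elim (labels-apart u q p m (here refl))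
R>-⊑-labelled u (⊑-∧ˡ {a = a} p) (⊑-∧ˡ q) m = R>-⊑-labelled (unique-++⁻ˡ (labels a) u) p q m
R>-⊑-labelled u (⊑-∧ʳ {a = a} p) (⊑-∧ʳ q) m = R>-⊑-labelled (unique-++⁻ʳ (labels a) u) p q m
R>-⊑-labelled u (⊑-∧ˡ p) (⊑-∧ʳ q) m = ⊥-elim (labels-apart u p q (here refl) m)
R>-⊑-labelled u (⊑-∧ʳ p) (⊑-∧ˡ q) m = ⊥-elim (labels-apart u q p m (here refl))
R>-⊑-labelled u (⊑-Uˡ {a = a} p) (⊑-Uˡ q) m = R>-⊑-labelled (unique-++⁻ˡ (labels a) u) p q m
R>-⊑-labelled u (⊑-Uʳ {a = a} p) (⊑-Uʳ q) m = R>-⊑-labelled (unique-++⁻ʳ (labels a) u) p q m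
R>-⊑-labelled u (⊑-Uˡ p) (⊑-Uʳ q) m = ⊥-elim (labels-apart u p q (here refl) m)
R>-⊑-labelled u (⊑-Uʳ p) (⊑-Uˡ q) m = ⊥-elim (labels-apart u q p m (here refl))
R>-⊑-labelled u (⊑-Rˡ {a = a} p) (⊑-Rˡ q) m = R>-⊑-labelled (unique-++⁻ˡ (labels a) u) p q m
R>-⊑-labelled u (⊑-Rʳ {a = a} p) (⊑-Rʳ q) m = R>-⊑-labelled (unique-++⁻ʳ (labels a) u) p q m
R>-⊑-labelled u (⊑-Rˡ p) (⊑-Rʳ q) m = ⊥-elim (labels-apart u p q (here refl) m)
R>-⊑-labelled u (⊑-Rʳ p) (⊑-Rˡ q) m = ⊥-elim (labels-apart u q p m (here refl))
R>-⊑-labelled u (⊑-X p) (⊑-X q) m = R>-⊑-labelled u p q m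
R>-⊑-labelled (_ ∷ u) (⊑-R>ˡ {a = a} p) (⊑-R>ˡ q) m =
  R>-⊑-labelled (unique-++⁻ˡ (labels a) u) p q m
R>-⊑-labelled (_ ∷ u) (⊑-R>ʳ {a = a} p) (⊑-R>ʳ q) m =
  R>-⊑-labelled (unique-++⁻ʳ (labels a) u) p q m
R>-⊑-labelled (_ ∷ u) (⊑-R>ˡ p) (⊑-R>ʳ q) m = ⊥-elim (labels-apart u p q (here refl) m)
R>-⊑-labelled (_ ∷ u) (⊑-R>ʳ p) (⊑-R>ˡ q) m = ⊥-elim (labels-apart u q p m (here refl))

reduct-members : ∀ {Y ψ act Z χ} → Red Y ψ act Z → Z χ →
  (Y χ × χ ≢ ψ) ⊎ χ ⊏ ψ ⊎ χ ≡ X ψ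
reduct-members (r-∧ a b)    (inj₁ (inj₁ y))         = inj₁ y
reduct-members (r-∧ a b)    (inj₁ (inj₂ refl))      = inj₂ (inj₁ (⊑-∧ˡ ⊑-refl , λ ()))
reduct-members (r-∧ a b)    (inj₂ refl)             = inj₂ (inj₁ (⊑-∧ʳ ⊑-refl , λ ()))
reduct-members (r-∨ˡ a b)   (inj₁ y)                = inj₁ y
reduct-members (r-∨ˡ a b)   (inj₂ refl)             = inj₂ (inj₁ (⊑-∨ˡ ⊑-refl , λ ()))
reduct-members (r-∨ʳ a b)   (inj₁ y)                = inj₁ y
reduct-members (r-∨ʳ a b)   (inj₂ refl)             = inj₂ (inj₁ (⊑-∨ʳ ⊑-refl , λ ()))
reduct-members (r-U₁ a b)   (inj₁ y)                = inj₁ y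
reduct-members (r-U₁ a b)   (inj₂ refl)             = inj₂ (inj₁ (⊑-Uʳ ⊑-refl , λ ()))
reduct-members (r-U₂ a b)   (inj₁ (inj₁ y))         = inj₁ y
reduct-members (r-U₂ a b)   (inj₁ (inj₂ refl))      = inj₂ (inj₁ (⊑-Uˡ ⊑-refl , λ ()))
reduct-members (r-U₂ a b)   (inj₂ refl)             = inj₂ (inj₂ refl)
reduct-members (r-R₁ a b)   (inj₁ (inj₁ y))         = inj₁ y
reduct-members (r-R₁ a b)   (inj₁ (inj₂ refl))      = inj₂ (inj₁ (⊑-Rˡ ⊑-refl , λ ()))
reduct-members (r-R₁ a b)   (inj₂ refl)             = inj₂ (inj₁ (⊑-Rʳ ⊑-refl , λ ()))
reduct-members (r-R₂ a b)   (inj₁ (inj₁ y))         = inj₁ y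
reduct-members (r-R₂ a b)   (inj₁ (inj₂ refl))      = inj₂ (inj₁ (⊑-Rʳ ⊑-refl , λ ()))
reduct-members (r-R₂ a b)   (inj₂ refl)             = inj₂ (inj₂ refl)
reduct-members (r-R>₁ i a b) (inj₁ (inj₁ y))        = inj₁ y
reduct-members (r-R>₁ i a b) (inj₁ (inj₂ refl))     = inj₂ (inj₁ (⊑-R>ˡ ⊑-refl , λ ()))
reduct-members (r-R>₁ i a b) (inj₂ refl)            = inj₂ (inj₁ (⊑-R>ʳ ⊑-refl , λ ()))
reduct-members (r-R>₂ i a b) (inj₁ (inj₁ (inj₁ y))) = inj₁ y
reduct-members (r-R>₂ i a b) (inj₁ (inj₁ (inj₂ refl))) = inj₂ (inj₁ (⊑-R>ˡ ⊑-refl , λ ()))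
reduct-members (r-R>₂ i a b) (inj₁ (inj₂ refl))     = inj₂ (inj₁ (⊑-R>ʳ ⊑-refl , λ ()))
reduct-members (r-R>₂ i a b) (inj₂ refl)            = inj₂ (inj₂ refl)
reduct-members (r-R>₃ i a b) (inj₁ (inj₁ y))        = inj₁ y
reduct-members (r-R>₃ i a b) (inj₁ (inj₂ refl))     = inj₂ (inj₁ (⊑-R>ʳ ⊑-refl , λ ()))
reduct-members (r-R>₃ i a b) (inj₂ refl)            = inj₂ (inj₂ refl)

Closed : Formula → FSet → Set
Closed φ Y = ∀ χ → Y χ → InClosure φ χ

LabelFree : ℕ → FSet → Set
LabelFree i Y = ∀ χ → Y χ → ¬ Reduced χ → i ∉ labels χ

closed-nonReduced-⊑ : ∀ {φ Y ψ} → Closed φ Y → Y ψ → ¬ Reduced ψ → ψ ⊑ φ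
closed-nonReduced-⊑ {ψ = ψ} cl y nr with cl ψ y
... | inj₁ ψ⊑φ              = ψ⊑φ
... | inj₂ (ψ' , _ , refl)  = ⊥-elim (nr (red-X ψ'))

closed-step : ∀ {φ Y act Z} → Closed φ Y → Step Y act Z → Closed φ Z
closed-step cl (step ψ (y , nr , _) r) χ z with reduct-members r z
... | inj₁ (yχ , _)         = cl χ yχ
... | inj₂ (inj₁ (χ⊑ψ , _)) = inj₁ (⊑-trans χ⊑ψ (closed-nonReduced-⊑ cl y nr))
... | inj₂ (inj₂ refl)      = inj₂ (ψ , closed-nonReduced-⊑ cl y nr , refl)

labelFree-step : ∀ {i Y act Z} → LabelFree i Y → Step Y act Z → LabelFree i Z
labelFree-step free (step ψ (y , nr , _) r) χ z nrχ i∈ with reduct-members r z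
... | inj₁ (yχ , _)         = free χ yχ nrχ i∈
... | inj₂ (inj₁ (χ⊑ψ , _)) = free ψ y nr (labels-mono χ⊑ψ i∈)
... | inj₂ (inj₂ refl)      = nrχ (red-X ψ)

labelFree-after-R> : ∀ {φ Y i a b act Z} → Unique (labels φ) → Closed φ Y →
  MaximalNonReduced Y (R> i a b) → Red Y (R> i a b) act Z → LabelFree i Z
labelFree-after-R> u cl (y , nr , maximal) r χ z nrχ i∈ with reduct-members r z
... | inj₁ (yχ , χ≢) = maximal χ yχ nrχ (R>⊑χ , χ≢ ∘ sym)
  where R>⊑χ = R>-⊑-labelled u (closed-nonReduced-⊑ cl y nr) (closed-nonReduced-⊑ cl yχ nrχ) i∈
... | inj₂ (inj₁ χ⊏R>) = R>-label∉⊏ (unique-⊑ (closed-nonReduced-⊑ cl y nr) u) χ⊏R> i∈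
... | inj₂ (inj₂ refl) = nrχ (red-X _)

data ActsOn (i : ℕ) : Act → Set where
  inc : ActsOn i (inc i)
  or  : ActsOn i (or i)

actsOn? : ∀ i a → Dec (ActsOn i a)
actsOn? i (inc j) with i ≟ j
... | yes refl = yes inc
... | no i≢j   = no λ { inc → i≢j refl }
actsOn? i (or j) with i ≟ j
... | yes refl = yes or
... | no i≢j   = no λ { or → i≢j refl }
actsOn? i ε = no λ ()

countOn-acting : ∀ {i a as} → ActsOn i a → countOn i (a ∷ as) ≡ suc (countOn i as)
countOn-acting {i} inc rewrite dec-true (i ≟ i) refl = refl
countOn-acting {i} or  rewrite dec-true (i ≟ i) refl = refl

countOn-idle : ∀ {i a as} → ¬ ActsOn i a → countOn i (a ∷ as) ≡ countOn i as
countOn-idle {i} {inc j} ¬acts rewrite dec-false (i ≟ j) (λ { refl → ¬acts inc }) = refl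
countOn-idle {i} {or j}  ¬acts rewrite dec-false (i ≟ j) (λ { refl → ¬acts or }) = refl
countOn-idle {a = ε} _ = refl

acting-step-labelFree : ∀ {φ Y i act Z} → Unique (labels φ) → Closed φ Y →
  Step Y act Z → ActsOn i act → LabelFree i Z
acting-step-labelFree u cl (step _ mx r@(r-R>₂ _ _ _)) inc = labelFree-after-R> u cl mx r
acting-step-labelFree u cl (step _ mx r@(r-R>₁ _ _ _)) or  = labelFree-after-R> u cl mx r

labelFree⇒¬acting : ∀ {i Y act Z} → LabelFree i Y → Step Y act Z → ¬ ActsOn i act
labelFree⇒¬acting free (step _ (y , nr , _) (r-R>₂ _ _ _)) inc = free _ y nr (here refl)
labelFree⇒¬acting free (step _ (y , nr , _) (r-R>₁ _ _ _)) or  = free _ y nr (here refl)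

countOn-labelFree : ∀ {i Y as Z} → LabelFree i Y → Chain Y as Z → countOn i as ≡ 0
countOn-labelFree free done = refl
countOn-labelFree {i} free (_▸_ {a = a} s c) with actsOn? i a
... | yes acts = ⊥-elim (labelFree⇒¬acting free s acts)
... | no ¬acts = trans (countOn-idle ¬acts) (countOn-labelFree (labelFree-step free s) c)

countOn≤1 : ∀ {φ Y as Z} i → Unique (labels φ) → Closed φ Y → Chain Y as Z → countOn i as ≤ 1
countOn≤1 i u cl done = z≤n
countOn≤1 i u cl (_▸_ {a = a} {as} s c) with actsOn? i a
... | yes acts = ≤-reflexive (begin
      countOn i (a ∷ as)  ≡⟨ countOn-acting acts ⟩
      suc (countOn i as)  ≡⟨ cong suc (countOn-labelFree (acting-step-labelFree u cl s acts) c) ⟩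
      1                   ∎)
  where open ≡-Reasoning
... | no ¬acts = subst (_≤ 1) (sym (countOn-idle ¬acts)) (countOn≤1 i u (closed-step cl s) c)

proposition11 : (φ : Formula) → Unique (labels φ) →
    (Y : FSet) → (∀ χ → Y χ → InClosure φ χ) →
    (as : List Act) (Z : FSet) → Chain Y as Z →
    (i : ℕ) → countOn i as ≤ 1
proposition11 φ u Y cl as Z c i = countOn≤1 i u cl c
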